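{- Let $G$ be a graph of order $n$ with $\delta(G)\geq\frac56n$. Suppose that the edges of $G$ are coloured red, blue and green and there are exactly $2$ red components. Then there exists a monochromatic component of order at least $\frac n2$.
   Context: $\delta(G)$ denotes the minimum degree of $G$. For an edge-colouring of $G$, a monochromatic (e.g. red) component is a connected component of the graph formed by the edges of that colour (on the vertices incident with such edges); its order is its number of vertices. -}

module Defs where

open import Data.Nat using (ℕ; _+_; _*_; _≤_)
open import Data.Fin using (Fin)
open import Data.List using (List; map; allFin; length)
open import Data.Nat.ListAction using (sum)
open import Data.Maybe using (Maybe; just; nothing; is-just)
open import Data.Bool using (if_then_else_)
open import Data.Product using (∃; _×_; _,_)
open import Data.Sum using (_⊎_)
open import Relation.Nullary using (¬_)
open import Relation.Binary.PropositionalEquality using (_≡_)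
open import Relation.Binary.Construct.Closure.ReflexiveTransitive using (Star)
open import Data.List.Relation.Unary.All using (All)
open import Data.List.Relation.Unary.Unique.Propositional using (Unique)

data Colour : Set where
  red blue green : Colour

-- A 3-edge-coloured finite simple graph on vertex set Fin n:
-- col u v = nothing  means u,v are non-adjacent,
-- col u v = just x   means uv is an edge of colour x.
record ColouredGraph (n : ℕ) : Set where
  field
    col   : Fin n → Fin n → Maybe Colour
    sym   : ∀ u v → col u v ≡ col v u
    irrefl : ∀ v → col v v ≡ nothing
open ColouredGraph public

degree : ∀ {n} → ColouredGraph n → Fin n → ℕ
degree {n} G u = sum (map (λ v → if is-just (col G u v) then 1 else 0) (allFin n))

MinDegAtLeastFiveSixths : ∀ {n} → ColouredGraph n → Set
MinDegAtLeastFiveSixths {n} G = ∀ v → 5 * n ≤ 6 * degree G v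

Adj : ∀ {n} → ColouredGraph n → Colour → Fin n → Fin n → Set
Adj G x u v = col G u v ≡ just x

-- v is incident with an edge of colour x (so v is a vertex of the colour-x graph)
Incident : ∀ {n} → ColouredGraph n → Colour → Fin n → Set
Incident G x v = ∃ λ w → Adj G x v w

Conn : ∀ {n} → ColouredGraph n → Colour → Fin n → Fin n → Set
Conn G x = Star (Adj G x)

ExactlyTwoComponents : ∀ {n} → ColouredGraph n → Colour → Set
ExactlyTwoComponents G x =
  ∃ λ a → ∃ λ b → Incident G x a × Incident G x b × ¬ Conn G x a b ×
    (∀ v → Incident G x v → Conn G x a v ⊎ Conn G x b v)

HasMonoComponentOfHalfOrder : ∀ {n} → ColouredGraph n → Set
HasMonoComponentOfHalfOrder {n} G =
  ∃ λ x → ∃ λ v → Incident G x v ×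
    ∃ λ (ws : List (Fin n)) → Unique ws × All (Conn G x v) ws × n ≤ 2 * length ws

-- Some vertex exists, and δ(G) ≥ 5n/6 together with deg v < n gives
-- n ≥ 6.  If every vertex lies on a red edge, the two red components cover
-- all n vertices, so one of them has at least n/2 of them.  Otherwise let v
-- have no red edge, and let B, Γ be its blue and green components; assume
-- both have fewer than n/2 vertices.  Every neighbour of v lies in B ∪ Γ, so
-- P = B ∖ Γ and Q = Γ ∖ B each have more than n/3 vertices.  An edge between
-- P and Q can be neither blue nor green, so it is red.  Counting degrees,
-- any two vertices of P have a common neighbour in Q and every vertex of Q
-- has a neighbour in P; hence P ∪ Q lies in one red component, of order
-- |P| + |Q| > 2n/3.
module Submission where

open import Defs
open import Data.Nat using (ℕ; zero; suc; _+_; _*_; _≤_; _<_; z≤n; s≤s; _≤?_; _<?_)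
open import Data.Nat.Properties
open import Data.Nat.Tactic.RingSolver using (solve-∀)
open import Data.Nat.ListAction using (sum)
open import Data.Fin using (Fin; zero; suc)
open import Data.Fin.Properties using (any?; all?; ¬∀⟶∃¬)
open import Data.Fin.Subset
  using (Subset; inside; outside; _∈_; _∉_; _⊆_; _⊃_; _∪_; _∩_; ∁; ∣_∣; ⊤; ⁅_⁆; Nonempty; Empty)
open import Data.Fin.Subset.Properties
  using ( _∈?_; x∈p∪q⁻; x∈p∪q⁺; p⊆p∪q; x∈p∩q⁺; x∈p∩q⁻; x∈∁p⇒x∉p; x∉p⇒x∈∁p
        ; p∩q⊆q; x∈⁅x⁆; x∈⁅y⁆⇒x≡y; ∣⁅x⁆∣≡1; ∈⊤; ⊆⊤; ∣⊤∣≡n; ∣⊥∣≡0; nonempty?; Empty-unique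
        ; p⊆q⇒∣p∣≤∣q∣; p⊂q⇒∣p∣<∣q∣)
open import Data.Fin.Subset.Induction using (Acc; acc; ⊃-wellFounded)
open import Data.Vec using ([]; _∷_; tabulate)
open import Data.Vec.Properties using (lookup∘tabulate; []=⇒lookup; lookup⇒[]=)
open import Data.List using (filter; allFin; length; map)
import Data.List as List
import Data.List.Relation.Unary.All as All
open import Data.List.Relation.Unary.All.Properties using (all-filter)
open import Data.List.Relation.Unary.Unique.Propositional.Properties using (filter⁺; allFin⁺)
open import Data.Bool using (Bool; true; false; if_then_else_)
open import Data.Maybe using (just; nothing; is-just)
open import Data.Maybe.Properties using (≡-dec)
open import Data.Product using (∃; _×_; _,_; proj₁; proj₂; map₂)
open import Data.Sum using (_⊎_; inj₁; inj₂; [_,_]′)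
import Data.Sum as Sum
open import Function using (_∘_; id)
open import Relation.Nullary using (¬_; Dec; yes; no; contradiction)
open import Relation.Nullary.Decidable using (_×-dec_; ¬?)
open import Relation.Binary.PropositionalEquality
  using (_≡_; refl; cong; trans; subst) renaming (sym to ≡-sym)
open import Relation.Binary.Construct.Closure.ReflexiveTransitive using (Star; ε; _◅_; _◅◅_)

order>2 : ∀ {n d} → 5 * n ≤ 6 * d → d < n → 2 < n
order>2 {n} {d} 5n≤6d d<n = ≤-trans (s≤s (s≤s (s≤s z≤n))) (+-cancelˡ-≤ (5 * n) 6 n (begin
  5 * n + 6  ≤⟨ +-monoˡ-≤ 6 5n≤6d ⟩
  6 * d + 6  ≡⟨ e₁ d ⟩
  6 * suc d  ≤⟨ *-monoʳ-≤ 6 d<n ⟩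
  6 * n      ≡⟨ e₂ n ⟩
  5 * n + n  ∎))
  where
  open ≤-Reasoning
  e₁ : ∀ d → 6 * d + 6 ≡ 6 * suc d
  e₁ = solve-∀
  e₂ : ∀ n → 6 * n ≡ 5 * n + n
  e₂ = solve-∀

half-of-sum : ∀ {n a b} → n ≤ a + b → n ≤ 2 * a ⊎ n ≤ 2 * b
half-of-sum {n} {a} {b} n≤a+b with n ≤? 2 * a | n ≤? 2 * b
... | yes n≤2a | _        = inj₁ n≤2a
... | no _     | yes n≤2b = inj₂ n≤2b
... | no n≰2a  | no n≰2b  = contradiction (begin-strict
  2 * n          ≤⟨ *-monoʳ-≤ 2 n≤a+b ⟩
  2 * (a + b)    ≡⟨ *-distribˡ-+ 2 a b ⟩
  2 * a + 2 * b  <⟨ +-mono-< (≰⇒> n≰2a) (≰⇒> n≰2b) ⟩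
  n + n          ≡⟨ cong (n +_) (≡-sym (+-identityʳ n)) ⟩
  2 * n          ∎) (<-irrefl refl)
  where open ≤-Reasoning

-- A vertex of degree d ≥ 5n/6 whose neighbours lie in a set of g < n/2
-- vertices and a set of p vertices has p > n/3.
third-of-remainder : ∀ {n d g p} → 5 * n ≤ 6 * d → d ≤ g + p → 2 * g < n → n < 3 * p
third-of-remainder {n} {d} {g} {p} 5n≤6d d≤g+p 2g<n with n <? 3 * p
... | yes n<3p = n<3p
... | no n≮3p  = contradiction (begin-strict
  5 * n                      ≤⟨ 5n≤6d ⟩
  6 * d                      ≤⟨ *-monoʳ-≤ 6 d≤g+p ⟩
  6 * (g + p)                ≡⟨ e₁ g p ⟩
  2 * (3 * p) + 3 * (2 * g)  <⟨ +-mono-≤-< (*-monoʳ-≤ 2 (≮⇒≥ n≮3p)) (*-monoʳ-< 3 2g<n) ⟩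
  2 * n + 3 * n              ≡⟨ e₂ n ⟩
  5 * n                      ∎) (<-irrefl refl)
  where
  open ≤-Reasoning
  e₁ : ∀ g p → 6 * (g + p) ≡ 2 * (3 * p) + 3 * (2 * g)
  e₁ = solve-∀
  e₂ : ∀ n → 2 * n + 3 * n ≡ 5 * n
  e₂ = solve-∀

-- A vertex of degree d ≥ 5n/6 has a neighbour in any set of p > n/3
-- vertices: if d + p ≤ n + r, where r counts those neighbours, then r > 0.
neighbour-in-third : ∀ {n d p r} → 5 * n ≤ 6 * d → d + p ≤ n + r → n < 3 * p → 0 < r
neighbour-in-third {r = suc _} _ _ _ = s≤s z≤n
neighbour-in-third {n} {d} {p} {zero} 5n≤6d d+p≤n+0 n<3p = contradiction (begin-strict
  6 * n                ≡⟨ e₁ n ⟩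
  5 * n + n            ≤⟨ +-monoʳ-≤ (5 * n) (m≤m+n n (n + 0)) ⟩
  5 * n + 2 * n        <⟨ +-monoʳ-< (5 * n) (*-monoʳ-< 2 n<3p) ⟩
  5 * n + 2 * (3 * p)  ≤⟨ +-monoˡ-≤ (2 * (3 * p)) 5n≤6d ⟩
  6 * d + 2 * (3 * p)  ≡⟨ e₂ d p ⟩
  6 * (d + p)          ≤⟨ *-monoʳ-≤ 6 d+p≤n+0 ⟩
  6 * (n + 0)          ≡⟨ e₃ n ⟩
  6 * n                ∎) (<-irrefl refl)
  where
  open ≤-Reasoning
  e₁ : ∀ n → 6 * n ≡ 5 * n + n
  e₁ = solve-∀
  e₂ : ∀ d p → 6 * d + 2 * (3 * p) ≡ 6 * (d + p)
  e₂ = solve-∀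
  e₃ : ∀ n → 6 * (n + 0) ≡ 6 * n
  e₃ = solve-∀

-- Two vertices of degree ≥ 5n/6, with r₀ ≥ d₀ + q − n and r₁ ≥ d₁ + q − n
-- neighbours in a set of q > n/3 vertices, have a common neighbour there:
-- if r₀ + r₁ ≤ q + i, where i counts the common neighbours, then i > 0.
common-in-third : ∀ {n d₀ d₁ q r₀ r₁ i} → 5 * n ≤ 6 * d₀ → 5 * n ≤ 6 * d₁ →
  d₀ + q ≤ n + r₀ → d₁ + q ≤ n + r₁ → r₀ + r₁ ≤ q + i → n < 3 * q → 0 < i
common-in-third {i = suc _} _ _ _ _ _ _ = s≤s z≤n
common-in-third {n} {d₀} {d₁} {q} {r₀} {r₁} {zero} 5n≤6d₀ 5n≤6d₁ h₀ h₁ r₀+r₁≤q+0 n<3q =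
  contradiction (begin-strict
  6 * q + 12 * n                           ≡⟨ e₁ n q ⟩
  (5 * n + 5 * n + 6 * q) + 2 * n          <⟨ +-monoʳ-< (5 * n + 5 * n + 6 * q) (*-monoʳ-< 2 n<3q) ⟩
  (5 * n + 5 * n + 6 * q) + 2 * (3 * q)    ≤⟨ +-monoˡ-≤ (2 * (3 * q)) (+-monoˡ-≤ (6 * q) (+-mono-≤ 5n≤6d₀ 5n≤6d₁)) ⟩
  (6 * d₀ + 6 * d₁ + 6 * q) + 2 * (3 * q)  ≡⟨ e₂ d₀ d₁ q ⟩
  6 * (d₀ + q) + 6 * (d₁ + q)              ≤⟨ +-mono-≤ (*-monoʳ-≤ 6 h₀) (*-monoʳ-≤ 6 h₁) ⟩
  6 * (n + r₀) + 6 * (n + r₁)              ≡⟨ e₃ n r₀ r₁ ⟩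
  6 * (r₀ + r₁) + 12 * n                   ≤⟨ +-monoˡ-≤ (12 * n) (*-monoʳ-≤ 6 r₀+r₁≤q+0) ⟩
  6 * (q + 0) + 12 * n                     ≡⟨ e₄ n q ⟩
  6 * q + 12 * n                           ∎) (<-irrefl refl)
  where
  open ≤-Reasoning
  e₁ : ∀ n q → 6 * q + 12 * n ≡ (5 * n + 5 * n + 6 * q) + 2 * n
  e₁ = solve-∀
  e₂ : ∀ a b q → (6 * a + 6 * b + 6 * q) + 2 * (3 * q) ≡ 6 * (a + q) + 6 * (b + q)
  e₂ = solve-∀
  e₃ : ∀ n a b → 6 * (n + a) + 6 * (n + b) ≡ 6 * (a + b) + 12 * n
  e₃ = solve-∀
  e₄ : ∀ n q → 6 * (q + 0) + 12 * n ≡ 6 * q + 12 * n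
  e₄ = solve-∀

half-of-two-thirds : ∀ {n p q} → n < 3 * p → n < 3 * q → n ≤ 2 * (p + q)
half-of-two-thirds {n} {p} {q} n<3p n<3q = *-cancelˡ-≤ 2 (begin
  2 * n              ≤⟨ m≤n+m (2 * n) 2 ⟩
  2 + 2 * n          ≡⟨ e₁ n ⟩
  suc n + suc n      ≤⟨ +-mono-≤ n<3p n<3q ⟩
  3 * p + 3 * q      ≤⟨ +-mono-≤ (*-monoˡ-≤ p (n≤1+n 3)) (*-monoˡ-≤ q (n≤1+n 3)) ⟩
  4 * p + 4 * q      ≡⟨ e₂ p q ⟩
  2 * (2 * (p + q))  ∎)
  where
  open ≤-Reasoning
  e₁ : ∀ n → 2 + 2 * n ≡ suc n + suc n
  e₁ = solve-∀
  e₂ : ∀ p q → 4 * p + 4 * q ≡ 2 * (2 * (p + q))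
  e₂ = solve-∀

∣p∪q∣+∣p∩q∣ : ∀ {n} (p q : Subset n) → ∣ p ∪ q ∣ + ∣ p ∩ q ∣ ≡ ∣ p ∣ + ∣ q ∣
∣p∪q∣+∣p∩q∣ []            []            = refl
∣p∪q∣+∣p∩q∣ (inside  ∷ p) (inside  ∷ q) =
  cong suc (trans (+-suc _ _) (trans (cong suc (∣p∪q∣+∣p∩q∣ p q)) (≡-sym (+-suc _ _))))
∣p∪q∣+∣p∩q∣ (inside  ∷ p) (outside ∷ q) = cong suc (∣p∪q∣+∣p∩q∣ p q)
∣p∪q∣+∣p∩q∣ (outside ∷ p) (inside  ∷ q) = trans (cong suc (∣p∪q∣+∣p∩q∣ p q)) (≡-sym (+-suc _ _))
∣p∪q∣+∣p∩q∣ (outside ∷ p) (outside ∷ q) = ∣p∪q∣+∣p∩q∣ p q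

∣p∪q∣≤∣p∣+∣q∣ : ∀ {n} (p q : Subset n) → ∣ p ∪ q ∣ ≤ ∣ p ∣ + ∣ q ∣
∣p∪q∣≤∣p∣+∣q∣ p q = ≤-trans (m≤m+n ∣ p ∪ q ∣ ∣ p ∩ q ∣) (≤-reflexive (∣p∪q∣+∣p∩q∣ p q))

overlap-bound : ∀ {n} {p q u : Subset n} → p ⊆ u → q ⊆ u → ∣ p ∣ + ∣ q ∣ ≤ ∣ u ∣ + ∣ p ∩ q ∣
overlap-bound {p = p} {q} {u} p⊆u q⊆u = begin
  ∣ p ∣ + ∣ q ∣          ≡⟨ ≡-sym (∣p∪q∣+∣p∩q∣ p q) ⟩
  ∣ p ∪ q ∣ + ∣ p ∩ q ∣  ≤⟨ +-monoˡ-≤ ∣ p ∩ q ∣ (p⊆q⇒∣p∣≤∣q∣ p∪q⊆u) ⟩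
  ∣ u ∣ + ∣ p ∩ q ∣      ∎
  where
  open ≤-Reasoning
  p∪q⊆u : p ∪ q ⊆ u
  p∪q⊆u x∈p∪q = [ p⊆u , q⊆u ]′ (x∈p∪q⁻ p q x∈p∪q)

∣p∣+∣q∣≤n+∣p∩q∣ : ∀ {n} (p q : Subset n) → ∣ p ∣ + ∣ q ∣ ≤ n + ∣ p ∩ q ∣
∣p∣+∣q∣≤n+∣p∩q∣ {n} p q =
  subst (λ m → ∣ p ∣ + ∣ q ∣ ≤ m + ∣ p ∩ q ∣) (∣⊤∣≡n n) (overlap-bound {p = p} {q} {⊤} ⊆⊤ ⊆⊤)

∣empty∣≡0 : ∀ {n} {p : Subset n} → Empty p → ∣ p ∣ ≡ 0
∣empty∣≡0 {n} empty = trans (cong ∣_∣ (Empty-unique empty)) (∣⊥∣≡0 n)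

nonempty : ∀ {n} (p : Subset n) → 0 < ∣ p ∣ → Nonempty p
nonempty p 0<∣p∣ with nonempty? p
... | yes ne    = ne
... | no empty  = contradiction (∣empty∣≡0 empty) (>⇒≢ 0<∣p∣)

∈-diff⁺ : ∀ {n} {p q : Subset n} {x} → x ∈ p → x ∉ q → x ∈ p ∩ ∁ q
∈-diff⁺ x∈p x∉q = x∈p∩q⁺ (x∈p , x∉p⇒x∈∁p x∉q)

∈-diff⁻ : ∀ {n} {p q : Subset n} {x} → x ∈ p ∩ ∁ q → x ∈ p × x ∉ q
∈-diff⁻ {p = p} {q} x∈p∖q = map₂ x∈∁p⇒x∉p (x∈p∩q⁻ p (∁ q) x∈p∖q)

∈-tabulate⁺ : ∀ {n} (f : Fin n → Bool) {i} → f i ≡ true → i ∈ tabulate f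
∈-tabulate⁺ f {i} fi≡true = lookup⇒[]= i (tabulate f) (trans (lookup∘tabulate f i) fi≡true)

∈-tabulate⁻ : ∀ {n} (f : Fin n → Bool) {i} → i ∈ tabulate f → f i ≡ true
∈-tabulate⁻ f {i} i∈f = trans (≡-sym (lookup∘tabulate f i)) ([]=⇒lookup i∈f)

sum-indicator : ∀ {A : Set} {n} (b : A → Bool) (f : Fin n → A) →
  sum (map (λ a → if b a then 1 else 0) (List.tabulate f)) ≡ ∣ tabulate (b ∘ f) ∣
sum-indicator {n = zero}  b f = refl
sum-indicator {n = suc n} b f with b (f zero)
... | true  = cong suc (sum-indicator b (f ∘ suc))
... | false = sum-indicator b (f ∘ suc)

length-filter-suc : ∀ {m n} s (p : Subset n) (f : Fin m → Fin n) →
  length (filter (_∈? (s ∷ p)) (List.tabulate (suc ∘ f)))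
    ≡ length (filter (_∈? p) (List.tabulate f))
length-filter-suc {zero}  s p f = refl
length-filter-suc {suc m} s p f with f zero ∈? p
... | yes _ = cong suc (length-filter-suc s p (f ∘ suc))
... | no _  = length-filter-suc s p (f ∘ suc)

length-filter-∈ : ∀ {n} (p : Subset n) → length (filter (_∈? p) (allFin n)) ≡ ∣ p ∣
length-filter-∈ []            = refl
length-filter-∈ (inside  ∷ p) = cong suc (trans (length-filter-suc inside p id) (length-filter-∈ p))
length-filter-∈ (outside ∷ p) = trans (length-filter-suc outside p id) (length-filter-∈ p)

-- Reachability along a decidable relation R on Fin n is decidable: the set
-- of vertices reachable from v is computed by repeatedly adding a vertex
-- joined by R to the current set, until no such vertex is left.
module Reachability {n : ℕ} {R : Fin n → Fin n → Set} (R? : ∀ u w → Dec (R u w)) (v : Fin n) where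

  Reached : Subset n → Set
  Reached S = ∀ {w} → w ∈ S → Star R v w

  Closed : Subset n → Set
  Closed S = ∀ {u w} → u ∈ S → R u w → w ∈ S

  exit? : ∀ S → Dec (∃ λ u → ∃ λ w → u ∈ S × w ∉ S × R u w)
  exit? S = any? λ u → any? λ w → u ∈? S ×-dec ¬? (w ∈? S) ×-dec R? u w

  explore : ∀ S → Acc _⊃_ S → Reached S → ∃ λ C → S ⊆ C × Reached C × Closed C
  explore S (acc rec) reached with exit? S
  ... | yes (u , w , u∈S , w∉S , uRw) =
    let C , S∪w⊆C , reachedC , closedC = explore S∪w (rec S⊂S∪w) reached∪w
    in C , S∪w⊆C ∘ p⊆p∪q ⁅ w ⁆ , reachedC , closedC
    where
    S∪w = S ∪ ⁅ w ⁆
    S⊂S∪w : S∪w ⊃ S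
    S⊂S∪w = p⊆p∪q ⁅ w ⁆ , w , x∈p∪q⁺ (inj₂ (x∈⁅x⁆ w)) , w∉S
    reached∪w : Reached S∪w
    reached∪w x∈S∪w with x∈p∪q⁻ S ⁅ w ⁆ x∈S∪w
    ... | inj₁ x∈S  = reached x∈S
    ... | inj₂ x∈⁅w⁆ rewrite x∈⁅y⁆⇒x≡y w x∈⁅w⁆ = reached u∈S ◅◅ (uRw ◅ ε)
  ... | no noExit = S , id , reached , closed
    where
    closed : Closed S
    closed {u} {w} u∈S uRw with w ∈? S
    ... | yes w∈S = w∈S
    ... | no w∉S  = contradiction (u , w , u∈S , w∉S , uRw) noExit

  private
    exploration : ∃ λ C → ⁅ v ⁆ ⊆ C × Reached C × Closed C
    exploration = explore ⁅ v ⁆ (⊃-wellFounded ⁅ v ⁆)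
      λ w∈⁅v⁆ → subst (Star R v) (≡-sym (x∈⁅y⁆⇒x≡y v w∈⁅v⁆)) ε

  -- The set of vertices reachable from v.  It is used only through its
  -- specification, so it is kept opaque.
  opaque
    reach : Subset n
    reach = proj₁ exploration

    reach-sound : ∀ {w} → w ∈ reach → Star R v w
    reach-sound = proj₁ (proj₂ (proj₂ exploration))

    reach-complete : ∀ {w} → Star R v w → w ∈ reach
    reach-complete = go (proj₁ (proj₂ exploration) (x∈⁅x⁆ v))
      where
      go : ∀ {u w} → u ∈ reach → Star R u w → w ∈ reach
      go u∈C ε          = u∈C
      go u∈C (uRx ◅ xs) = go (proj₂ (proj₂ (proj₂ exploration)) u∈C uRx) xs

_≟ᶜ_ : (x y : Colour) → Dec (x ≡ y)
red   ≟ᶜ red   = yes refl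
red   ≟ᶜ blue  = no λ ()
red   ≟ᶜ green = no λ ()
blue  ≟ᶜ red   = no λ ()
blue  ≟ᶜ blue  = yes refl
blue  ≟ᶜ green = no λ ()
green ≟ᶜ red   = no λ ()
green ≟ᶜ blue  = no λ ()
green ≟ᶜ green = yes refl

module _ {n : ℕ} (G : ColouredGraph n) where

  adj? : ∀ x u w → Dec (Adj G x u w)
  adj? x u w = ≡-dec _≟ᶜ_ (col G u w) (just x)

  adj-sym : ∀ {x u w} → Adj G x u w → Adj G x w u
  adj-sym {u = u} {w} uw = trans (sym G w u) uw

  incident? : ∀ x v → Dec (Incident G x v)
  incident? x v = any? (adj? x v)

  nbhd : Fin n → Subset n
  nbhd u = tabulate λ w → is-just (col G u w)

  degree≡∣nbhd∣ : ∀ u → degree G u ≡ ∣ nbhd u ∣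
  degree≡∣nbhd∣ u = sum-indicator (λ w → is-just (col G u w)) id

  nbhd⁺ : ∀ {x u w} → Adj G x u w → w ∈ nbhd u
  nbhd⁺ {u = u} {w} uw = ∈-tabulate⁺ (λ w → is-just (col G u w)) (cong is-just uw)

  nbhd-colour : ∀ {u w} → w ∈ nbhd u → ∃ λ x → Adj G x u w
  nbhd-colour {u} {w} w∈Nu with col G u w | ∈-tabulate⁻ (λ w → is-just (col G u w)) w∈Nu
  ... | just x  | _  = x , refl
  ... | nothing | ()

  nbhd-sym : ∀ {u w} → w ∈ nbhd u → u ∈ nbhd w
  nbhd-sym w∈Nu = nbhd⁺ (adj-sym (proj₂ (nbhd-colour w∈Nu)))

  u∉nbhd : ∀ u → u ∉ nbhd u
  u∉nbhd u u∈Nu with col G u u | irrefl G u | ∈-tabulate⁻ (λ w → is-just (col G u w)) u∈Nu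
  ... | nothing | refl | ()

  ∣nbhd∣<n : ∀ u → ∣ nbhd u ∣ < n
  ∣nbhd∣<n u = subst (∣ nbhd u ∣ <_) (∣⊤∣≡n n) (p⊂q⇒∣p∣<∣q∣ (⊆⊤ , u , ∈⊤ , u∉nbhd u))

  component : Colour → Fin n → Subset n
  component x v = Reachability.reach (adj? x) v

  component-sound : ∀ {x v w} → w ∈ component x v → Conn G x v w
  component-sound {x} {v} = Reachability.reach-sound (adj? x) v

  component-complete : ∀ {x v w} → Conn G x v w → w ∈ component x v
  component-complete {x} {v} = Reachability.reach-complete (adj? x) v

  isolated-component : ∀ {x v} → ¬ Incident G x v → component x v ⊆ ⁅ v ⁆
  isolated-component {x} {v} ¬inc w∈C with component-sound w∈C
  ... | ε      = x∈⁅x⁆ v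
  ... | vu ◅ _ = contradiction (_ , vu) ¬inc

  -- When n > 2, an x-component with at least n/2 vertices is a genuine
  -- monochromatic component (its vertex v lies on an x-edge), and listing its
  -- vertices witnesses the conclusion of the theorem.
  large-component : ∀ x v → 2 < n → n ≤ 2 * ∣ component x v ∣ → HasMonoComponentOfHalfOrder G
  large-component x v 2<n large with incident? x v
  ... | yes inc = x , v , inc , filter (_∈? C) (allFin n) ,
    filter⁺ (_∈? C) (allFin⁺ n) ,
    All.map component-sound (all-filter (_∈? C) (allFin n)) ,
    subst (λ m → n ≤ 2 * m) (≡-sym (length-filter-∈ C)) large
    where C = component x v
  ... | no ¬inc = contradiction (≤-trans large (*-monoʳ-≤ 2 ∣C∣≤1)) (<⇒≱ 2<n)
    where
    ∣C∣≤1 : ∣ component x v ∣ ≤ 1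
    ∣C∣≤1 = ≤-trans (p⊆q⇒∣p∣≤∣q∣ (isolated-component ¬inc)) (≤-reflexive (∣⁅x⁆∣≡1 v))

spanning-red : ∀ {n} (G : ColouredGraph n) → 2 < n → ExactlyTwoComponents G red →
  (∀ v → Incident G red v) → HasMonoComponentOfHalfOrder G
spanning-red {n} G 2<n (a , b , _ , _ , _ , cover) spanning =
  [ large-component G red a 2<n , large-component G red b 2<n ]′
    (half-of-sum {a = ∣ A ∣} {∣ B ∣} n≤∣A∣+∣B∣)
  where
  A = component G red a
  B = component G red b

  covered : ⊤ ⊆ A ∪ B
  covered {w} _ =
    x∈p∪q⁺ (Sum.map (component-complete G) (component-complete G) (cover w (spanning w)))

  n≤∣A∣+∣B∣ : n ≤ ∣ A ∣ + ∣ B ∣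
  n≤∣A∣+∣B∣ = begin
    n              ≡⟨ ≡-sym (∣⊤∣≡n n) ⟩
    ∣ ⊤ {n} ∣      ≤⟨ p⊆q⇒∣p∣≤∣q∣ covered ⟩
    ∣ A ∪ B ∣      ≤⟨ ∣p∪q∣≤∣p∣+∣q∣ A B ⟩
    ∣ A ∣ + ∣ B ∣  ∎
    where open ≤-Reasoning

module _ {n : ℕ} (G : ColouredGraph n) (δ : ∀ u → 5 * n ≤ 6 * ∣ nbhd G u ∣) (2<n : 2 < n) where

  -- If all edges at v have colour x or y and the y-component of v has fewer
  -- than n/2 vertices, then more than n/3 vertices lie in the x-component of
  -- v but not in its y-component: N(v) is covered by these two sets.
  beyond-small-component : ∀ {v} x y → (∀ {w} → w ∈ nbhd G v → Adj G x v w ⊎ Adj G y v w) →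
    2 * ∣ component G y v ∣ < n → n < 3 * ∣ component G x v ∩ ∁ (component G y v) ∣
  beyond-small-component {v} x y two-coloured small =
    third-of-remainder {g = ∣ Cy ∣} {∣ Cx ∩ ∁ Cy ∣} (δ v) d≤ small
    where
    Cx = component G x v
    Cy = component G y v

    N⊆ : nbhd G v ⊆ Cy ∪ (Cx ∩ ∁ Cy)
    N⊆ {w} w∈N with w ∈? Cy | two-coloured w∈N
    ... | yes w∈Cy | _      = x∈p∪q⁺ (inj₁ w∈Cy)
    ... | no w∉Cy  | inj₁ vw = x∈p∪q⁺ (inj₂ (∈-diff⁺ (component-complete G (vw ◅ ε)) w∉Cy))
    ... | no w∉Cy  | inj₂ vw = contradiction (component-complete G (vw ◅ ε)) w∉Cy

    d≤ : ∣ nbhd G v ∣ ≤ ∣ Cy ∣ + ∣ Cx ∩ ∁ Cy ∣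
    d≤ = ≤-trans (p⊆q⇒∣p∣≤∣q∣ N⊆) (∣p∪q∣≤∣p∣+∣q∣ Cy (Cx ∩ ∁ Cy))

  neighbour-in : ∀ {S} u → n < 3 * ∣ S ∣ → Nonempty (nbhd G u ∩ S)
  neighbour-in {S} u S-large =
    nonempty _ (neighbour-in-third {p = ∣ S ∣} {∣ nbhd G u ∩ S ∣} (δ u)
      (∣p∣+∣q∣≤n+∣p∩q∣ (nbhd G u) S) S-large)

  -- Any two vertices have a common neighbour in any set S of more than n/3
  -- vertices: each has at least deg + ∣S∣ − n neighbours in S.
  common-neighbour-in : ∀ {S} u w → n < 3 * ∣ S ∣ → Nonempty ((nbhd G u ∩ S) ∩ (nbhd G w ∩ S))
  common-neighbour-in {S} u w S-large = nonempty _
    (common-in-third {q = ∣ S ∣} {∣ Nu∩S ∣} {∣ Nw∩S ∣} (δ u) (δ w)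
      (∣p∣+∣q∣≤n+∣p∩q∣ (nbhd G u) S) (∣p∣+∣q∣≤n+∣p∩q∣ (nbhd G w) S)
      (overlap-bound (p∩q⊆q (nbhd G u) S) (p∩q⊆q (nbhd G w) S)) S-large)
    where
    Nu∩S = nbhd G u ∩ S
    Nw∩S = nbhd G w ∩ S

  module WithoutRedEdge (v : Fin n) (no-red : ¬ Incident G red v) where
    B Γ P Q : Subset n
    B = component G blue v
    Γ = component G green v
    P = B ∩ ∁ Γ
    Q = Γ ∩ ∁ B

    blue-or-green : ∀ {w} → w ∈ nbhd G v → Adj G blue v w ⊎ Adj G green v w
    blue-or-green w∈N with nbhd-colour G w∈N
    ... | red   , vw = contradiction (_ , vw) no-red
    ... | blue  , vw = inj₁ vw
    ... | green , vw = inj₂ vw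

    -- A blue edge zq would put q into B, a green one would put z into Γ.
    P-Q-edge-red : ∀ {z q} → z ∈ P → q ∈ Q → q ∈ nbhd G z → Adj G red z q
    P-Q-edge-red z∈P q∈Q q∈Nz with ∈-diff⁻ z∈P | ∈-diff⁻ q∈Q | nbhd-colour G q∈Nz
    ... | _         | _         | red   , zq = zq
    ... | z∈B , _   | _ , q∉B   | blue  , zq =
      contradiction (component-complete G (component-sound G z∈B ◅◅ (zq ◅ ε))) q∉B
    ... | _ , z∉Γ   | q∈Γ , _   | green , zq =
      contradiction (component-complete G (component-sound G q∈Γ ◅◅ (adj-sym G zq ◅ ε))) z∉Γ

    module BothSmall (B-small : 2 * ∣ B ∣ < n) (Γ-small : 2 * ∣ Γ ∣ < n) where
      P-large : n < 3 * ∣ P ∣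
      P-large = beyond-small-component blue green blue-or-green Γ-small

      Q-large : n < 3 * ∣ Q ∣
      Q-large = beyond-small-component green blue (Sum.swap ∘ blue-or-green) B-small

      P-nonempty : Nonempty P
      P-nonempty = nonempty P (*-cancelˡ-< 3 0 ∣ P ∣ (≤-trans (s≤s z≤n) P-large))

      z₀ : Fin n
      z₀ = proj₁ P-nonempty

      R : Subset n
      R = component G red z₀

      -- z₀ and any z ∈ P have a common neighbour in Q; both edges are red.
      P⊆R : P ⊆ R
      P⊆R {z} z∈P with common-neighbour-in z₀ z Q-large
      ... | q , q∈both with x∈p∩q⁻ _ _ q∈both
      ... | q∈N₀∩Q , q∈N∩Q with x∈p∩q⁻ _ _ q∈N₀∩Q | x∈p∩q⁻ _ _ q∈N∩Q
      ... | q∈N₀ , q∈Q | q∈N , _ = component-complete G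
        (P-Q-edge-red (proj₂ P-nonempty) q∈Q q∈N₀ ◅ adj-sym G (P-Q-edge-red z∈P q∈Q q∈N) ◅ ε)

      -- Any q ∈ Q has a neighbour z ∈ P, and z ∈ R with zq red.
      Q⊆R : Q ⊆ R
      Q⊆R {q} q∈Q with neighbour-in q P-large
      ... | z , z∈N∩P with x∈p∩q⁻ _ _ z∈N∩P
      ... | z∈Nq , z∈P = component-complete G
        (component-sound G (P⊆R z∈P) ◅◅ (P-Q-edge-red z∈P q∈Q (nbhd-sym G z∈Nq) ◅ ε))

      P-Q-disjoint : Empty (P ∩ Q)
      P-Q-disjoint (x , x∈P∩Q) with x∈p∩q⁻ P Q x∈P∩Q
      ... | x∈P , x∈Q = proj₂ (∈-diff⁻ x∈Q) (proj₁ (∈-diff⁻ x∈P))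

      R-large : n ≤ 2 * ∣ R ∣
      R-large = ≤-trans (half-of-two-thirds {p = ∣ P ∣} {∣ Q ∣} P-large Q-large) (*-monoʳ-≤ 2 (begin
        ∣ P ∣ + ∣ Q ∣          ≤⟨ overlap-bound P⊆R Q⊆R ⟩
        ∣ R ∣ + ∣ P ∩ Q ∣      ≡⟨ cong (∣ R ∣ +_) (∣empty∣≡0 P-Q-disjoint) ⟩
        ∣ R ∣ + 0              ≡⟨ +-identityʳ ∣ R ∣ ⟩
        ∣ R ∣                  ∎))
        where open ≤-Reasoning

      large-red-component : HasMonoComponentOfHalfOrder G
      large-red-component = large-component G red z₀ 2<n R-large

    large-mono-component : HasMonoComponentOfHalfOrder G
    large-mono-component with n ≤? 2 * ∣ B ∣ | n ≤? 2 * ∣ Γ ∣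
    ... | yes B-large | _           = large-component G blue v 2<n B-large
    ... | no _        | yes Γ-large = large-component G green v 2<n Γ-large
    ... | no B-small  | no Γ-small  = BothSmall.large-red-component (≰⇒> B-small) (≰⇒> Γ-small)

lemma3p3 : (n : ℕ) (G : ColouredGraph n) →
    MinDegAtLeastFiveSixths G →
    ExactlyTwoComponents G red →
    HasMonoComponentOfHalfOrder G
lemma3p3 n G min-degree two-red@(a , _) = by-red-spanning (all? (incident? G red))
  where
  δ : ∀ u → 5 * n ≤ 6 * ∣ nbhd G u ∣
  δ u = subst (λ d → 5 * n ≤ 6 * d) (degree≡∣nbhd∣ G u) (min-degree u)

  2<n : 2 < n
  2<n = order>2 (δ a) (∣nbhd∣<n G a)

  by-red-spanning : Dec (∀ v → Incident G red v) → HasMonoComponentOfHalfOrder G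
  by-red-spanning (yes spanning) = spanning-red G 2<n two-red spanning
  by-red-spanning (no ¬spanning) =
    let v , v-off-red = ¬∀⟶∃¬ n (Incident G red) (incident? G red) ¬spanning
    in WithoutRedEdge.large-mono-component G δ 2<n v v-off-red
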